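{- Let $r=2^t$ for some positive integer $t$, let $x$ be a positive integer, and let $n$ be a multiple of $r^x$. Suppose $X=\{\pi_1,\dots,\pi_x\}$ is a set of permutations of $[n]$. Then there exist pairwise disjoint sets $A_1,\dots,A_r\subset[n]$ that are consistent with $X$, with $|A_j|=n/r^x$ for $1\le j\le r$.
   Context: For nonempty disjoint $A,B\subset[n]$ and a permutation $\pi$ of $[n]$, write $A\Rightarrow B$ in $\pi$ if all elements of $A$ come before all elements of $B$ in $\pi$. Nonempty disjoint sets $A_1,\dots,A_r\subset[n]$ are consistent with $X$ if for every $\pi_i\in X$ and all $j\ne j'$, either $A_j\Rightarrow A_{j'}$ in $\pi_i$ or $A_{j'}\Rightarrow A_j$ in $\pi_i$. -}

module Defs where


open import Data.Nat using (ℕ; _<_)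
open import Data.Fin using (Fin)
open import Data.Fin.Subset using (Subset; _∈_; Nonempty; Empty; _∩_)
open import Data.Fin.Permutation using (Permutation′; _⟨$⟩ˡ_)
open import Data.Sum using (_⊎_)
open import Data.Product using (_×_)
open import Data.Fin using () renaming (_<_ to _<ᶠ_)
open import Relation.Binary.PropositionalEquality using (_≢_)

-- A permutation π of [n] is viewed as a listing: π ⟨$⟩ʳ i is the element in
-- position i; hence the position of element e in π is π ⟨$⟩ˡ e.
position : ∀ {n} → Permutation′ n → Fin n → Fin n
position π e = π ⟨$⟩ˡ e

_⇒_within_ : ∀ {n} → Subset n → Subset n → Permutation′ n → Set
A ⇒ B within π = ∀ a b → a ∈ A → b ∈ B → position π a <ᶠ position π b

Disjoint : ∀ {n} → Subset n → Subset n → Set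
Disjoint A B = Empty (A ∩ B)

ConsistentWith : ∀ {n r x} → (Fin r → Subset n) → (Fin x → Permutation′ n) → Set
ConsistentWith {r = r} A X =
  (∀ j → Nonempty (A j)) × ((∀ j j' → j ≢ j' → Disjoint (A j) (A j')) ×
  (∀ i j j' → j ≢ j' → (A j ⇒ A j' within X i) ⊎ (A j' ⇒ A j within X i)))

{-# OPTIONS --safe #-}

-- Call A, B separated in π when one lies entirely before the other. By induction on the
-- number x of permutations, any S with |S| ≥ 2^x m contains two m-sets separated in every
-- π_i: take such sets of size 2m for π_2, …, π_x and cut each one at the point of π_1 in
-- front of which m of its elements lie. Splitting every part into two in this way t times
-- yields 2^t parts of size n / 2^(tx), pairwise separated in every π_i; separation in a
-- single permutation already forces disjointness.
module Submission where

open import Data.Fin using (Fin; zero; suc; toℕ; splitAt; fromℕ<)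
open import Data.Fin.Properties using (toℕ-injective; toℕ<n; +↔⊎)
import Data.Fin.Properties as Fin
open import Data.Fin.Permutation using (Permutation′; _⟨$⟩ʳ_; inverseʳ)
open import Data.Fin.Subset
open import Data.Fin.Subset.Properties
open import Data.Nat using (ℕ; zero; suc; _+_; _*_; _^_; _≤_; _<_; z≤n; s≤s; s≤s⁻¹)
open import Data.Nat.Divisibility using (_∣_; divides)
open import Data.Nat.Properties
open import Data.Nat.Tactic.RingSolver using (solve-∀)
open import Data.Product using (Σ; ∃; ∃₂; _×_; _,_; proj₂)
open import Data.Sum using (_⊎_; inj₁; inj₂; [_,_]′)
open import Data.Vec using ([]; _∷_; here; there; tabulate)
open import Data.Vec.Functional using (_++_)
open import Data.Vec.Properties using (lookup∘tabulate; []=⇒lookup; lookup⇒[]=)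
open import Function using (_∘_; Injective; Injection)
open import Function.Properties.Inverse using (↔⇒↣)
open import Level using (Level)
open import Relation.Binary.PropositionalEquality
open import Relation.Nullary using (yes; no; does; contradiction)
open import Relation.Nullary.Decidable using (dec-true)
open import Relation.Unary using (Pred; Decidable)

open import Defs

private
  variable
    ℓ : Level
    n : ℕ

⊆-of-size : ∀ {m} (S : Subset n) → m ≤ ∣ S ∣ → ∃ λ T → T ⊆ S × ∣ T ∣ ≡ m
⊆-of-size {n} {zero} S _ = ⊥ , ⊥⊆ , ∣⊥∣≡0 n
⊆-of-size (outside ∷ S) m≤∣S∣ with ⊆-of-size S m≤∣S∣
... | T , T⊆S , ∣T∣≡m = outside ∷ T , out⊆ T⊆S , ∣T∣≡m
⊆-of-size {m = suc m} (inside ∷ S) (s≤s m≤∣S∣) with ⊆-of-size S m≤∣S∣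
... | T , T⊆S , ∣T∣≡m = inside ∷ T , s⊆s T⊆S , cong suc ∣T∣≡m

x∈p─q⇒x∉q : ∀ (p q : Subset n) {x} → x ∈ p ─ q → x ∉ q
x∈p─q⇒x∉q (_ ∷ p) (inside ∷ q) () here
x∈p─q⇒x∉q (_ ∷ p) (_ ∷ q) (there x∈p─q) (there x∈q) = x∈p─q⇒x∉q p q x∈p─q x∈q

∣q∣≤suc∣p∣ : {p q : Subset n} → p ⊆ q → (∀ {x y} → x ∈ q ─ p → y ∈ q ─ p → x ≡ y) →
             ∣ q ∣ ≤ suc ∣ p ∣
∣q∣≤suc∣p∣ {p = []} {[]} _ _ = z≤n
∣q∣≤suc∣p∣ {p = s ∷ p} {outside ∷ q} p⊆q unique =
  ≤-trans (∣q∣≤suc∣p∣ (drop-∷-⊆ p⊆q) (λ x∈ y∈ → Fin.suc-injective (unique (there x∈) (there y∈))))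
          (s≤s (∣p∣≤∣x∷p∣ s p))
∣q∣≤suc∣p∣ {p = inside ∷ p} {inside ∷ q} p⊆q unique =
  s≤s (∣q∣≤suc∣p∣ (drop-∷-⊆ p⊆q) (λ x∈ y∈ → Fin.suc-injective (unique (there x∈) (there y∈))))
∣q∣≤suc∣p∣ {p = outside ∷ p} {inside ∷ q} _ unique = s≤s (p⊆q⇒∣p∣≤∣q∣ q⊆p)
  where
  q⊆p : q ⊆ p
  q⊆p {x} x∈q with x ∈? p
  ... | yes x∈p = x∈p
  ... | no x∉p with () ← unique here (there (x∈p∧x∉q⇒x∈p─q x∈q x∉p))

∣p∩q∣+∣p∩∁q∣≡∣p∣ : ∀ (p q : Subset n) → ∣ p ∩ q ∣ + ∣ p ∩ ∁ q ∣ ≡ ∣ p ∣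
∣p∩q∣+∣p∩∁q∣≡∣p∣ []            []            = refl
∣p∩q∣+∣p∩∁q∣≡∣p∣ (outside ∷ p) (_ ∷ q)       = ∣p∩q∣+∣p∩∁q∣≡∣p∣ p q
∣p∩q∣+∣p∩∁q∣≡∣p∣ (inside ∷ p)  (inside ∷ q)  = cong suc (∣p∩q∣+∣p∩∁q∣≡∣p∣ p q)
∣p∩q∣+∣p∩∁q∣≡∣p∣ (inside ∷ p)  (outside ∷ q) =
  trans (+-suc ∣ p ∩ q ∣ ∣ p ∩ ∁ q ∣) (cong suc (∣p∩q∣+∣p∩∁q∣≡∣p∣ p q))

b≤∣p∩∁q∣ : ∀ {a b} (p q : Subset n) → a + b ≤ ∣ p ∣ → ∣ p ∩ q ∣ ≤ a → b ≤ ∣ p ∩ ∁ q ∣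
b≤∣p∩∁q∣ {a = a} {b} p q a+b≤∣p∣ ∣p∩q∣≤a = +-cancelˡ-≤ a _ _ (begin
  a + b                         ≤⟨ a+b≤∣p∣ ⟩
  ∣ p ∣                         ≡⟨ ∣p∩q∣+∣p∩∁q∣≡∣p∣ p q ⟨
  ∣ p ∩ q ∣ + ∣ p ∩ ∁ q ∣       ≤⟨ +-monoˡ-≤ _ ∣p∩q∣≤a ⟩
  a + ∣ p ∩ ∁ q ∣               ∎)
  where open ≤-Reasoning

0<∣p∣⇒Nonempty : {p : Subset n} → 0 < ∣ p ∣ → Nonempty p
0<∣p∣⇒Nonempty {n} {p} 0<∣p∣ with nonempty? p
... | yes nonempty = nonempty
... | no empty = contradiction (trans (cong ∣_∣ (Empty-unique empty)) (∣⊥∣≡0 n)) (>⇒≢ 0<∣p∣)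

select : {P : Pred (Fin n) ℓ} → Decidable P → Subset n
select P? = tabulate (does ∘ P?)

module _ {P : Pred (Fin n) ℓ} (P? : Decidable P) {x : Fin n} where

  ∈-select⁺ : P x → x ∈ select P?
  ∈-select⁺ Px = lookup⇒[]= x _ (trans (lookup∘tabulate _ x) (dec-true (P? x) Px))

  ∈-select⁻ : x ∈ select P? → P x
  ∈-select⁻ x∈ with P? x | trans (sym (lookup∘tabulate _ x)) ([]=⇒lookup x∈)
  ... | yes Px | _  = Px
  ... | no _   | ()

unit-step-ivt : (g : ℕ → ℕ) → g 0 ≡ 0 → (∀ k → g (suc k) ≤ suc (g k)) →
  ∀ {m} N → m ≤ g N → ∃ λ k → g k ≡ m
unit-step-ivt g g0≡0 step zero m≤g0 = 0 , trans g0≡0 (sym (n≤0⇒n≡0 (subst (_ ≤_) g0≡0 m≤g0)))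
unit-step-ivt g g0≡0 step {m} (suc N) m≤gN+1 with m ≤? g N
... | yes m≤gN = unit-step-ivt g g0≡0 step N m≤gN
... | no m≰gN = suc N , ≤-antisym (≤-trans (step N) (≰⇒> m≰gN)) m≤gN+1

position-injective : ∀ (π : Permutation′ n) {a b} → position π a ≡ position π b → a ≡ b
position-injective π {a} {b} eq = begin
  a                           ≡⟨ inverseʳ π ⟨
  π ⟨$⟩ʳ position π a         ≡⟨ cong (π ⟨$⟩ʳ_) eq ⟩
  π ⟨$⟩ʳ position π b         ≡⟨ inverseʳ π ⟩
  b                           ∎
  where open ≡-Reasoning

⇒-mono : ∀ (π : Permutation′ n) {A B A′ B′} → A′ ⊆ A → B′ ⊆ B → A ⇒ B within π → A′ ⇒ B′ within π
⇒-mono _ A′⊆A B′⊆B A⇒B a b a∈A′ b∈B′ = A⇒B a b (A′⊆A a∈A′) (B′⊆B b∈B′)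

Separated : Permutation′ n → Subset n → Subset n → Set
Separated π A B = A ⇒ B within π ⊎ B ⇒ A within π

Separated-mono : ∀ (π : Permutation′ n) {A B A′ B′} → A′ ⊆ A → B′ ⊆ B →
                 Separated π A B → Separated π A′ B′
Separated-mono π A′⊆A B′⊆B (inj₁ A⇒B) = inj₁ (⇒-mono π A′⊆A B′⊆B A⇒B)
Separated-mono π A′⊆A B′⊆B (inj₂ B⇒A) = inj₂ (⇒-mono π B′⊆B A′⊆A B⇒A)

Separated-sym : ∀ (π : Permutation′ n) {A B} → Separated π A B → Separated π B A
Separated-sym _ (inj₁ A⇒B) = inj₂ A⇒B
Separated-sym _ (inj₂ B⇒A) = inj₁ B⇒A

Separated⇒Disjoint : ∀ (π : Permutation′ n) {A B} → Separated π A B → Disjoint A B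
Separated⇒Disjoint _ {A} {B} sep (e , e∈A∩B) with x∈p∩q⁻ A B e∈A∩B | sep
... | e∈A , e∈B | inj₁ A⇒B = <-irrefl refl (A⇒B e e e∈A e∈B)
... | e∈A , e∈B | inj₂ B⇒A = <-irrefl refl (B⇒A e e e∈B e∈A)

module Threshold (π : Permutation′ n) where

  earlier? : ∀ k → Decidable (λ e → toℕ (position π e) < k)
  earlier? k e = toℕ (position π e) <? k

  before : ℕ → Subset n
  before k = select (earlier? k)

  ∩before⇒∩∁before : ∀ k (S T : Subset n) → (S ∩ before k) ⇒ (T ∩ ∁ (before k)) within π
  ∩before⇒∩∁before k S T a b a∈ b∈ =
    <-≤-trans (∈-select⁻ (earlier? k) (proj₂ (x∈p∩q⁻ S _ a∈)))
              (≮⇒≥ (x∈∁p⇒x∉p (proj₂ (x∈p∩q⁻ T _ b∈)) ∘ ∈-select⁺ (earlier? k)))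

  ∩before-mono : ∀ (S : Subset n) {k k′} → k ≤ k′ → S ∩ before k ⊆ S ∩ before k′
  ∩before-mono S k≤k′ e∈ with x∈p∩q⁻ S _ e∈
  ... | e∈S , e∈before =
    x∈p∩q⁺ (e∈S , ∈-select⁺ (earlier? _) (<-≤-trans (∈-select⁻ (earlier? _) e∈before) k≤k′))

  ∣∩before∣-mono : ∀ (S : Subset n) {k k′} → k ≤ k′ → ∣ S ∩ before k ∣ ≤ ∣ S ∩ before k′ ∣
  ∣∩before∣-mono S k≤k′ = p⊆q⇒∣p∣≤∣q∣ (∩before-mono S k≤k′)

  ∣∩before-0∣ : ∀ (S : Subset n) → ∣ S ∩ before 0 ∣ ≡ 0
  ∣∩before-0∣ S = trans (cong ∣_∣ (Empty-unique empty)) (∣⊥∣≡0 n)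
    where
    empty : Empty (S ∩ before 0)
    empty (e , e∈) with () ← ∈-select⁻ (earlier? 0) (proj₂ (x∈p∩q⁻ S _ e∈))

  ⊆∩before-n : ∀ (S : Subset n) → S ⊆ S ∩ before n
  ⊆∩before-n S {e} e∈S = x∈p∩q⁺ (e∈S , ∈-select⁺ (earlier? n) (toℕ<n (position π e)))

  ∣∩before-suc∣≤ : ∀ (S : Subset n) k → ∣ S ∩ before (suc k) ∣ ≤ suc ∣ S ∩ before k ∣
  ∣∩before-suc∣≤ S k = ∣q∣≤suc∣p∣ (∩before-mono S (n≤1+n k)) unique
    where
    at-k : ∀ {e} → e ∈ (S ∩ before (suc k)) ─ (S ∩ before k) → toℕ (position π e) ≡ k
    at-k e∈ with x∈p∩q⁻ S _ (p─q⊆p _ _ e∈)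
    ... | e∈S , e∈before =
      ≤-antisym (s≤s⁻¹ (∈-select⁻ (earlier? (suc k)) e∈before))
                (≮⇒≥ (λ <k → x∈p─q⇒x∉q _ _ e∈ (x∈p∩q⁺ (e∈S , ∈-select⁺ (earlier? k) <k))))

    unique : ∀ {x y} → x ∈ (S ∩ before (suc k)) ─ (S ∩ before k) →
                       y ∈ (S ∩ before (suc k)) ─ (S ∩ before k) → x ≡ y
    unique x∈ y∈ = position-injective π (toℕ-injective (trans (at-k x∈) (sym (at-k y∈))))

  threshold : ∀ (S : Subset n) {m} → m ≤ ∣ S ∣ → ∃ λ k → ∣ S ∩ before k ∣ ≡ m
  threshold S m≤∣S∣ = unit-step-ivt (λ k → ∣ S ∩ before k ∣) (∣∩before-0∣ S) (∣∩before-suc∣≤ S) n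
                        (≤-trans m≤∣S∣ (p⊆q⇒∣p∣≤∣q∣ (⊆∩before-n S)))

  separate-at : ∀ k {A₀ B₀ : Subset n} {m} →
    ∣ A₀ ∩ before k ∣ ≡ m → ∣ B₀ ∩ before k ∣ ≤ m → m + m ≤ ∣ B₀ ∣ →
    ∃₂ λ A B → A ⊆ A₀ × B ⊆ B₀ × ∣ A ∣ ≡ m × ∣ B ∣ ≡ m × A ⇒ B within π
  separate-at k {A₀} {B₀} ∣A₀∩before∣≡m ∣B₀∩before∣≤m 2m≤∣B₀∣
    with ⊆-of-size (B₀ ∩ ∁ (before k)) (b≤∣p∩∁q∣ B₀ (before k) 2m≤∣B₀∣ ∣B₀∩before∣≤m)
  ... | B , B⊆ , ∣B∣≡m =
    A₀ ∩ before k , B , p∩q⊆p A₀ _ , p∩q⊆p B₀ _ ∘ B⊆ , ∣A₀∩before∣≡m , ∣B∣≡m ,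
    ⇒-mono π ⊆-refl B⊆ (∩before⇒∩∁before k A₀ B₀)

  -- Cut A₀ and B₀ where m of their elements lie in front; at the earlier of the two cuts,
  -- at most m elements of the other set lie in front, so at least m lie behind.
  halve : ∀ {A₀ B₀ : Subset n} {m} → m + m ≤ ∣ A₀ ∣ → m + m ≤ ∣ B₀ ∣ →
    ∃₂ λ A B → A ⊆ A₀ × B ⊆ B₀ × ∣ A ∣ ≡ m × ∣ B ∣ ≡ m × Separated π A B
  halve {A₀} {B₀} {m} 2m≤∣A₀∣ 2m≤∣B₀∣
    with threshold A₀ (≤-trans (m≤m+n m m) 2m≤∣A₀∣) | threshold B₀ (≤-trans (m≤m+n m m) 2m≤∣B₀∣)
  ... | kA , ∣A₀∩before∣≡m | kB , ∣B₀∩before∣≡m with ≤-total kA kB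
  ... | inj₁ kA≤kB =
    let (A , B , A⊆A₀ , B⊆B₀ , ∣A∣≡m , ∣B∣≡m , A⇒B) =
          separate-at kA ∣A₀∩before∣≡m
            (≤-trans (∣∩before∣-mono B₀ kA≤kB) (≤-reflexive ∣B₀∩before∣≡m)) 2m≤∣B₀∣
    in A , B , A⊆A₀ , B⊆B₀ , ∣A∣≡m , ∣B∣≡m , inj₁ A⇒B
  ... | inj₂ kB≤kA =
    let (B , A , B⊆B₀ , A⊆A₀ , ∣B∣≡m , ∣A∣≡m , B⇒A) =
          separate-at kB ∣B₀∩before∣≡m
            (≤-trans (∣∩before∣-mono A₀ kB≤kA) (≤-reflexive ∣A₀∩before∣≡m)) 2m≤∣A₀∣
    in A , B , A⊆A₀ , B⊆B₀ , ∣A∣≡m , ∣B∣≡m , inj₂ B⇒A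

PairwiseSeparated : ∀ {x} {I : Set} → (Fin x → Permutation′ n) → (I → Subset n) → Set
PairwiseSeparated X A = ∀ i j j′ → j ≢ j′ → Separated (X i) (A j) (A j′)

PairwiseSeparated-reindex : ∀ {x} {I J : Set} {X : Fin x → Permutation′ n} {A : I → Subset n}
  {f : J → I} → Injective _≡_ _≡_ f → PairwiseSeparated X A → PairwiseSeparated X (A ∘ f)
PairwiseSeparated-reindex f-injective sep i j j′ j≢j′ = sep i _ _ (j≢j′ ∘ f-injective)

splitAt-injective : ∀ m {n} → Injective _≡_ _≡_ (splitAt m {n})
splitAt-injective m = Injection.injective (↔⇒↣ (+↔⊎ {m}))

separated-pair : ∀ {x} (X : Fin x → Permutation′ n) {S : Subset n} m → 2 ^ x * m ≤ ∣ S ∣ →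
  ∃₂ λ A B → A ⊆ S × B ⊆ S × ∣ A ∣ ≡ m × ∣ B ∣ ≡ m × (∀ i → Separated (X i) A B)
separated-pair {x = zero} X {S} m m≤∣S∣ with ⊆-of-size S (subst (_≤ ∣ S ∣) (+-identityʳ m) m≤∣S∣)
... | T , T⊆S , ∣T∣≡m = T , T , T⊆S , T⊆S , ∣T∣≡m , ∣T∣≡m , λ ()
separated-pair {x = suc x} X {S} m 2^[1+x]m≤∣S∣
  with separated-pair (X ∘ suc) (m + m) (subst (_≤ ∣ S ∣) (sym (double (2 ^ x) m)) 2^[1+x]m≤∣S∣)
  where
  double : ∀ a m → a * (m + m) ≡ 2 * a * m
  double = solve-∀
... | A₀ , B₀ , A₀⊆S , B₀⊆S , ∣A₀∣≡2m , ∣B₀∣≡2m , sep₀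
  with Threshold.halve (X zero) (≤-reflexive (sym ∣A₀∣≡2m)) (≤-reflexive (sym ∣B₀∣≡2m))
... | A , B , A⊆A₀ , B⊆B₀ , ∣A∣≡m , ∣B∣≡m , sep =
  A , B , ⊆-trans A⊆A₀ A₀⊆S , ⊆-trans B⊆B₀ B₀⊆S , ∣A∣≡m , ∣B∣≡m , λ
  { zero    → sep
  ; (suc i) → Separated-mono (X (suc i)) A⊆A₀ B⊆B₀ (sep₀ i) }

record SeparatedParts {x} (X : Fin x → Permutation′ n) (S : Subset n) (r m : ℕ) : Set where
  field
    part      : Fin r → Subset n
    part⊆S    : ∀ j → part j ⊆ S
    ∣part∣≡m  : ∀ j → ∣ part j ∣ ≡ m
    separated : PairwiseSeparated X part

SeparatedParts-++ : ∀ {x} {X : Fin x → Permutation′ n} {A₀ B₀ S : Subset n} {r s m} →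
  SeparatedParts X A₀ r m → SeparatedParts X B₀ s m →
  (∀ i → Separated (X i) A₀ B₀) → A₀ ⊆ S → B₀ ⊆ S → SeparatedParts X S (r + s) m
SeparatedParts-++ {n} {X = X} {S = S} {r} {s} {m} P Q sep A₀⊆S B₀⊆S = record
  { part      = P.part ++ Q.part
  ; part⊆S    = part⊆S ∘ splitAt r
  ; ∣part∣≡m  = ∣part∣≡m ∘ splitAt r
  ; separated = PairwiseSeparated-reindex {X = X} {A = part} (splitAt-injective r {s}) separated
  }
  where
  module P = SeparatedParts P
  module Q = SeparatedParts Q

  part : Fin r ⊎ Fin s → Subset n
  part = [ P.part , Q.part ]′

  part⊆S : ∀ c → part c ⊆ S
  part⊆S (inj₁ j) = ⊆-trans (P.part⊆S j) A₀⊆S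
  part⊆S (inj₂ j) = ⊆-trans (Q.part⊆S j) B₀⊆S

  ∣part∣≡m : ∀ c → ∣ part c ∣ ≡ m
  ∣part∣≡m (inj₁ j) = P.∣part∣≡m j
  ∣part∣≡m (inj₂ j) = Q.∣part∣≡m j

  separated : PairwiseSeparated X part
  separated i (inj₁ j) (inj₁ j′) j≢j′ = P.separated i j j′ (j≢j′ ∘ cong inj₁)
  separated i (inj₂ j) (inj₂ j′) j≢j′ = Q.separated i j j′ (j≢j′ ∘ cong inj₂)
  separated i (inj₁ j) (inj₂ j′) _    = Separated-mono (X i) (P.part⊆S j) (Q.part⊆S j′) (sep i)
  separated i (inj₂ j) (inj₁ j′) _    =
    Separated-sym (X i) (Separated-mono (X i) (P.part⊆S j′) (Q.part⊆S j) (sep i))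

separated-parts : ∀ t {x} (X : Fin x → Permutation′ n) {S : Subset n} m →
  2 ^ (t * x) * m ≤ ∣ S ∣ → SeparatedParts X S (2 ^ t) m
separated-parts zero X {S} m m≤∣S∣ with ⊆-of-size S (subst (_≤ ∣ S ∣) (+-identityʳ m) m≤∣S∣)
... | T , T⊆S , ∣T∣≡m = record
  { part      = λ _ → T
  ; part⊆S    = λ _ → T⊆S
  ; ∣part∣≡m  = λ _ → ∣T∣≡m
  ; separated = λ { _ zero zero 0≢0 → contradiction refl 0≢0 }
  }
separated-parts (suc t) {x} X {S} m 2^[[1+t]x]m≤∣S∣
  with separated-pair X (2 ^ (t * x) * m) (subst (_≤ ∣ S ∣) split 2^[[1+t]x]m≤∣S∣)
  where
  split : 2 ^ (suc t * x) * m ≡ 2 ^ x * (2 ^ (t * x) * m)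
  split = trans (cong (_* m) (^-distribˡ-+-* 2 x (t * x))) (*-assoc (2 ^ x) _ m)
... | A₀ , B₀ , A₀⊆S , B₀⊆S , ∣A₀∣≡ , ∣B₀∣≡ , sep =
  -- 2 ^ suc t unfolds to 2 ^ t + (2 ^ t + 0)
  subst (λ r → SeparatedParts X S r m) (cong (2 ^ t +_) (sym (+-identityʳ (2 ^ t))))
    (SeparatedParts-++ (separated-parts t X m (≤-reflexive (sym ∣A₀∣≡)))
                       (separated-parts t X m (≤-reflexive (sym ∣B₀∣≡)))
                       sep A₀⊆S B₀⊆S)

lemma5 : (t x n : ℕ) → 0 < t → 0 < x → 0 < n → (2 ^ t) ^ x ∣ n →
    (X : Fin x → Permutation′ n) →
    Σ (Fin (2 ^ t) → Subset n) λ A →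
      ConsistentWith A X × (∀ j → ∣ A j ∣ * (2 ^ t) ^ x ≡ n)
-- The bound holds for r = 1 as well.
lemma5 t x n _ 0<x 0<n (divides q n≡q*r^x) X =
  part , (nonempty , disjoint , separated) , size
  where
  2^[tx]q≡∣⊤∣ : 2 ^ (t * x) * q ≡ ∣ ⊤ {n} ∣
  2^[tx]q≡∣⊤∣ = begin
    2 ^ (t * x) * q ≡⟨ cong (_* q) (^-*-assoc 2 t x) ⟨
    (2 ^ t) ^ x * q ≡⟨ *-comm _ q ⟩
    q * (2 ^ t) ^ x ≡⟨ n≡q*r^x ⟨
    n               ≡⟨ ∣⊤∣≡n n ⟨
    ∣ ⊤ {n} ∣       ∎
    where open ≡-Reasoning

  open SeparatedParts (separated-parts t X {⊤ {n}} q (≤-reflexive 2^[tx]q≡∣⊤∣))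

  0<q : 0 < q
  0<q = n≢0⇒n>0 (λ q≡0 → >⇒≢ 0<n (trans n≡q*r^x (cong (_* _) q≡0)))

  nonempty : ∀ j → Nonempty (part j)
  nonempty j = 0<∣p∣⇒Nonempty (subst (0 <_) (sym (∣part∣≡m j)) 0<q)

  disjoint : ∀ j j′ → j ≢ j′ → Disjoint (part j) (part j′)
  disjoint j j′ j≢j′ = Separated⇒Disjoint (X (fromℕ< 0<x)) (separated (fromℕ< 0<x) j j′ j≢j′)

  size : ∀ j → ∣ part j ∣ * (2 ^ t) ^ x ≡ n
  size j = trans (cong (_* _) (∣part∣≡m j)) (sym n≡q*r^x)
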